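{- Let $G$ be a bi-block graph with vertices $v_1,\dots,v_N$ and blocks $K_{m_k,n_k}$ ($k=1,\dots,r$), let $q$ satisfy $q\neq -1$ and $q^2(m_k-1)(n_k-1)\neq 1$ for all $k$, let $\mathscr{D}$ be the $q$-distance matrix of $G$, and let $\mathbf{x}$ be the vector defined below. Then $$\sum_{i=1}^{N}\left(1+(q-1)\mathscr{D}_{iN}\right)\mathbf{x}_i=1.$$
   Context: $q$ is a real or complex number (the paper calls it an indeterminate). For an integer $\alpha\ge1$, $[\alpha]=1+q+\cdots+q^{\alpha-1}$, $[0]=0$; the $q$-distance matrix $\mathscr{D}$ of a connected graph with vertices $v_1,\dots,v_N$ has $(i,j)$ entry $\mathscr{D}_{ij}=[d(v_i,v_j)]$, $d$ the shortest-path distance. A block is a maximal connected subgraph without a cut-vertex. A bi-block graph is a connected graph each of whose blocks is a complete bipartite graph; its blocks are $K_{m_k,n_k}$, $k=1,\dots,r$, and in each block a bipartition $X_k\cup Y_k$ with $|X_k|=m_k$, $|Y_k|=n_k$ is fixed. For a vertex $v$ let $\hat d(v)$ be the number of blocks containing $v$, and put $\Delta_k=q^2(m_k-1)(n_k-1)-1$. The vector $\mathbf{x}$ is defined by $$\mathbf{x}(v)=\sum_{k:\,v\in X_k}\frac{q(n_k-1)-1}{(q+1)\Delta_k}+\sum_{k:\,v\in Y_k}\frac{q(m_k-1)-1}{(q+1)\Delta_k}-(\hat d(v)-1),$$ and $\mathbf{x}_i=\mathbf{x}(v_i)$. The vertex ordering is arbitrary. -}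

module Defs where

open import Level using (Level; _⊔_) renaming (suc to lsuc)
open import Data.Bool using (Bool; true; false; if_then_else_)
open import Data.Nat as ℕ using (ℕ; zero; suc; _≤_)
open import Data.Fin using (Fin; zero; suc)
open import Data.Fin.Subset using (Subset; _∈_; _∉_; _⊆_; _∪_; ∣_∣)
open import Data.Fin.Subset.Properties using (_∈?_)
open import Data.Product using (Σ; ∃; _×_; _,_)
open import Relation.Nullary using (¬_; does)
open import Relation.Binary.PropositionalEquality using (_≡_; _≢_)
open import Algebra.Bundles using (CommutativeRing)

-- Fields (not in agda-stdlib): a commutative ring with 0 ≠ 1 and a
-- total inverse operation that is a genuine inverse on nonzero elements
-- (the value of 0⁻¹ is irrelevant; it is never used under the hypotheses).

record Field (c ℓ : Level) : Set (lsuc (c ⊔ ℓ)) where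
  field
    commutativeRing : CommutativeRing c ℓ
  open CommutativeRing commutativeRing public
  field
    0≉1     : ¬ (0# ≈ 1#)
    _⁻¹     : Carrier → Carrier
    ⁻¹-inverse : ∀ x → ¬ (x ≈ 0#) → (x * (x ⁻¹)) ≈ 1#

module _ {c ℓ : Level} (F : Field c ℓ) where
  open Field F using (Carrier; 0#; 1#; _+_; _*_)

  fromℕ : ℕ → Carrier
  fromℕ zero    = 0#
  fromℕ (suc n) = 1# + fromℕ n

  pow : Carrier → ℕ → Carrier
  pow x zero    = 1#
  pow x (suc n) = x * pow x n

  qint : Carrier → ℕ → Carrier
  qint q zero    = 0#
  qint q (suc α) = qint q α + pow q α

  ∑ : ∀ {n} → (Fin n → Carrier) → Carrier
  ∑ {zero}  f = 0#
  ∑ {suc n} f = f zero + ∑ (λ i → f (suc i))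

record Graph (N : ℕ) : Set₁ where
  field
    Adj    : Fin N → Fin N → Set
    sym    : ∀ {u v} → Adj u v → Adj v u
    irrefl : ∀ {u} → ¬ Adj u u

module _ {N : ℕ} (G : Graph N) where
  open Graph G

  data WalkIn (P : Fin N → Set) : Fin N → Fin N → ℕ → Set where
    here : ∀ {u} → P u → WalkIn P u u 0
    step : ∀ {u v w n} → P u → Adj u v → WalkIn P v w n → WalkIn P u w (suc n)

  ConnectedOn : (Fin N → Set) → Set
  ConnectedOn P = ∀ u v → P u → P v → ∃ λ n → WalkIn P u v n

  AllV : Fin N → Set
  AllV _ = Fin N

  Connected : Set
  Connected = ConnectedOn AllV

  IsDistance : (Fin N → Fin N → ℕ) → Set
  IsDistance d = ∀ u v → WalkIn AllV u v (d u v) × (∀ n → WalkIn AllV u v n → d u v ≤ n)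

  HasCutVertex : Subset N → Set
  HasCutVertex S = ∃ λ v → v ∈ S × ¬ ConnectedOn (λ w → w ∈ S × w ≢ v)

  Biconn : Subset N → Set
  Biconn S = (∃ λ v → v ∈ S) × ConnectedOn (λ w → w ∈ S) × ¬ HasCutVertex S

  -- a block: maximal (vertex set of a) connected subgraph without cut-vertex
  -- (blocks are always induced subgraphs, so they are determined by vertex sets)
  IsBlock : Subset N → Set
  IsBlock S = Biconn S × (∀ S′ → S ⊆ S′ → Biconn S′ → S′ ⊆ S)

  CompleteBipartite : Subset N → Subset N → Set
  CompleteBipartite X Y =
    (∃ λ x → x ∈ X) × (∃ λ y → y ∈ Y) ×
    (∀ v → v ∈ X → v ∉ Y) ×
    (∀ x y → x ∈ X → y ∈ Y → Adj x y) ×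
    (∀ u v → u ∈ X → v ∈ X → ¬ Adj u v) ×
    (∀ u v → u ∈ Y → v ∈ Y → ¬ Adj u v)

record BiBlock {N : ℕ} (G : Graph N) : Set₁ where
  field
    r : ℕ
    X : Fin r → Subset N
    Y : Fin r → Subset N
    isBlock  : ∀ k → IsBlock G (X k ∪ Y k)
    complete : ∀ k → CompleteBipartite G (X k) (Y k)
    allBlocks : ∀ S → IsBlock G S → ∃ λ k → S ≡ X k ∪ Y k
    distinct  : ∀ k l → X k ∪ Y k ≡ X l ∪ Y l → k ≡ l

  m : Fin r → ℕ
  m k = ∣ X k ∣

  n : Fin r → ℕ
  n k = ∣ Y k ∣

module _ {c ℓ : Level} (F : Field c ℓ) {N : ℕ} {G : Graph N} (B : BiBlock G) where
  open Field F using (Carrier; 0#; 1#; _+_; _*_; _-_; _⁻¹)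
  open BiBlock B

  Δ : Carrier → Fin r → Carrier
  Δ q k = (q * q) * ((fromℕ F (m k) - 1#) * (fromℕ F (n k) - 1#)) - 1#

  dhat : Fin N → Carrier
  dhat v = ∑ F (λ k → if does (v ∈? (X k ∪ Y k)) then 1# else 0#)

  xvec : Carrier → Fin N → Carrier
  xvec q v =
      ∑ F (λ k → if does (v ∈? X k)
                 then (q * (fromℕ F (n k) - 1#) - 1#) * (((q + 1#) * Δ q k) ⁻¹)
                 else 0#)
    + ∑ F (λ k → if does (v ∈? Y k)
                 then (q * (fromℕ F (m k) - 1#) - 1#) * (((q + 1#) * Δ q k) ⁻¹)
                 else 0#)
    - (dhat v - 1#)

{-# OPTIONS --safe #-}
-- Write e(v) = q^d(v,w) for the last vertex w; since 1 + (q - 1)[α] = q^α, the claim is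
-- Σ_v e(v) x(v) = 1. Each block B_k = X_k ∪ Y_k has a gate g_k, its vertex nearest to w, and
-- d(v,w) = d(v,g_k) + d(g_k,w) for every v in B_k: otherwise a shortest walk to w would leave B_k
-- and return to it, giving B_k an ear. Inside K_{m,n} distances are 1 across and 2 within a side,
-- and the coefficients (q(n-1)-1)/((q+1)Δ) and (q(m-1)-1)/((q+1)Δ) of x are exactly such that
-- block k contributes e(g_k) to the sum. What remains is Σ_v e(v)(#{k | v = g_k} - #{k | v ∈ B_k} + 1),
-- and the bracket is [v = w]: w is the gate of every block containing it, while every other vertex
-- is a non-gate vertex of exactly one block (the one holding its first edge towards w).
module Submission where

open import Defs
open import Level using (Level)
open import Algebra.Bundles using (CommutativeRing)
open import Data.Nat as ℕ using (ℕ; zero; suc; _≤_; _<_; z≤n; s≤s)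
import Data.Nat.Properties as ℕ
open import Data.Nat.Induction using (<-rec)
open import Data.Fin as Fin using (Fin; zero; suc) renaming (fromℕ to lastOf)
open import Data.Fin.Properties using (any?; punchInᵢ≢i)
open import Data.Fin.Subset using (Subset; _∈_; _∉_; _⊆_; _⊂_; _∪_; ⁅_⁆; inside; outside)
open import Data.Fin.Subset.Properties
  using (_∈?_; x∈p∪q⁺; x∈p∪q⁻; x∈⁅x⁆; x∈⁅y⁆⇒x≡y; ⊆-refl; ⊆-trans; ⊆-antisym)
open import Data.Fin.Subset.Induction using (⊃-wellFounded)
open import Data.Bool using (if_then_else_)
open import Data.Vec using (_∷_; [])
open import Data.Integer as ℤ using (ℤ; +_; -[1+_])
open import Data.List using (allFin; filter)
open import Data.List.Extrema.Nat using (argmin; argmin-all; f[argmin]≤f[xs])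
open import Data.List.Membership.Propositional.Properties using (∈-filter⁺; ∈-allFin)
open import Data.List.Relation.Unary.All using (lookup)
open import Data.List.Relation.Unary.All.Properties using (all-filter)
open import Data.Maybe using (Maybe; just; nothing)
open import Data.Product using (Σ; ∃; _×_; _,_; proj₁; proj₂)
open import Data.Sum using (_⊎_; inj₁; inj₂; swap)
open import Data.Empty using (⊥; ⊥-elim)
open import Function using (_∘_)
open import Induction.WellFounded using (module All)
open import Relation.Nullary using (¬_; Dec; yes; no; does)
open import Relation.Nullary.Decidable using (¬¬-excluded-middle; decidable-stable; _×-dec_; ¬?)
open import Relation.Binary.PropositionalEquality as ≡ using (_≡_; _≢_; subst; subst₂; cong)

-- The reflective solver of the standard library takes its coefficients from the ring itself and so
-- cannot cancel 1# - 1#; hence the older solver, with integer coefficients. The optimised multiple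
-- _·_ makes fromℤ (+ 1) definitionally 1#, so that con (+ 1) denotes 1# on the nose.
module IntegerCoefficients {c ℓ : Level} (R : CommutativeRing c ℓ) where
  open import Algebra.Solver.Ring.AlmostCommutativeRing as ACR
    using (AlmostCommutativeRing; _-Raw-AlmostCommutative⟶_)
  import Algebra.Solver.Ring
  open import Data.Integer using (_⊖_; _◃_; sign; ∣_∣)
  import Data.Integer.Properties as ℤ
  open import Data.Sign as Sign using (Sign)
  open CommutativeRing R
  open import Algebra.Properties.Ring ring using (-0#≈0#; -‿involutive; -‿+-comm; -‿distribˡ-*; -‿distribʳ-*)
  open import Algebra.Properties.Semiring.Mult.TCOptimised semiring
    using (1+×; ×-homo-+; ×1-homo-*) renaming (_×_ to _·_)
  open import Relation.Binary.Reasoning.Setoid setoid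

  fromℤ : ℤ → Carrier
  fromℤ (+ n)    = n · 1#
  fromℤ -[1+ n ] = - (suc n · 1#)

  private
    x-y≈[1+x]-[1+y] : ∀ x y → x - y ≈ (1# + x) - (1# + y)
    x-y≈[1+x]-[1+y] x y = begin
      x - y                  ≈⟨ +-identityˡ _ ⟨
      0# + (x - y)           ≈⟨ +-congʳ (-‿inverseʳ 1#) ⟨
      (1# - 1#) + (x - y)    ≈⟨ +-assoc _ _ _ ⟩
      1# + (- 1# + (x - y))  ≈⟨ +-congˡ (+-assoc _ _ _) ⟨
      1# + ((- 1# + x) - y)  ≈⟨ +-congˡ (+-congʳ (+-comm _ _)) ⟩
      1# + ((x - 1#) - y)    ≈⟨ +-congˡ (+-assoc _ _ _) ⟩
      1# + (x + (- 1# - y))  ≈⟨ +-congˡ (+-congˡ (-‿+-comm _ _)) ⟩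
      1# + (x - (1# + y))    ≈⟨ +-assoc _ _ _ ⟨
      (1# + x) - (1# + y)    ∎

    fromℤ-⊖ : ∀ m n → fromℤ (m ⊖ n) ≈ m · 1# - n · 1#
    fromℤ-⊖ zero    zero    = sym (-‿inverseʳ 0#)
    fromℤ-⊖ zero    (suc n) = sym (+-identityˡ _)
    fromℤ-⊖ (suc m) zero    = sym (trans (+-congˡ -0#≈0#) (+-identityʳ _))
    fromℤ-⊖ (suc m) (suc n) = begin
      fromℤ (suc m ⊖ suc n)          ≡⟨ ≡.cong fromℤ (ℤ.[1+m]⊖[1+n]≡m⊖n m n) ⟩
      fromℤ (m ⊖ n)                  ≈⟨ fromℤ-⊖ m n ⟩
      m · 1# - n · 1#                ≈⟨ x-y≈[1+x]-[1+y] (m · 1#) (n · 1#) ⟩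
      (1# + m · 1#) - (1# + n · 1#)  ≈⟨ +-cong (1+× m 1#) (-‿cong (1+× n 1#)) ⟨
      suc m · 1# - suc n · 1#        ∎

    signed : Sign → Carrier → Carrier
    signed Sign.+ x = x
    signed Sign.- x = - x

    signed-cong : ∀ s {x y} → x ≈ y → signed s x ≈ signed s y
    signed-cong Sign.+ x≈y = x≈y
    signed-cong Sign.- x≈y = -‿cong x≈y

    signed-* : ∀ s t x y → signed (s Sign.* t) (x * y) ≈ signed s x * signed t y
    signed-* Sign.+ Sign.+ x y = refl
    signed-* Sign.+ Sign.- x y = -‿distribʳ-* x y
    signed-* Sign.- Sign.+ x y = -‿distribˡ-* x y
    signed-* Sign.- Sign.- x y = begin
      x * y        ≈⟨ -‿involutive _ ⟨
      - - (x * y)  ≈⟨ -‿cong (-‿distribˡ-* x y) ⟩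
      - (- x * y)  ≈⟨ -‿distribʳ-* _ _ ⟩
      - x * - y    ∎

    fromℤ-◃ : ∀ s n → fromℤ (s ◃ n) ≈ signed s (n · 1#)
    fromℤ-◃ Sign.+ zero    = refl
    fromℤ-◃ Sign.- zero    = sym -0#≈0#
    fromℤ-◃ Sign.+ (suc n) = refl
    fromℤ-◃ Sign.- (suc n) = refl

    fromℤ≈signed : ∀ i → fromℤ i ≈ signed (sign i) (∣ i ∣ · 1#)
    fromℤ≈signed (+ zero)  = refl
    fromℤ≈signed (+ suc n) = refl
    fromℤ≈signed -[1+ n ]  = refl

  fromℤ-‿homo : ∀ i → fromℤ (ℤ.- i) ≈ - fromℤ i
  fromℤ-‿homo (+ zero)  = sym -0#≈0#
  fromℤ-‿homo (+ suc n) = refl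
  fromℤ-‿homo -[1+ n ]  = sym (-‿involutive _)

  fromℤ-+-homo : ∀ i j → fromℤ (i ℤ.+ j) ≈ fromℤ i + fromℤ j
  fromℤ-+-homo (+ m)    (+ n)    = ×-homo-+ 1# m n
  fromℤ-+-homo (+ m)    -[1+ n ] = fromℤ-⊖ m (suc n)
  fromℤ-+-homo -[1+ m ] (+ n)    = trans (fromℤ-⊖ n (suc m)) (+-comm _ _)
  fromℤ-+-homo -[1+ m ] -[1+ n ] = begin
    - (suc (suc (m ℕ.+ n)) · 1#)     ≡⟨ ≡.cong (λ k → - (suc k · 1#)) (≡.sym (ℕ.+-suc m n)) ⟩
    - ((suc m ℕ.+ suc n) · 1#)       ≈⟨ -‿cong (×-homo-+ 1# (suc m) (suc n)) ⟩
    - (suc m · 1# + suc n · 1#)      ≈⟨ -‿+-comm _ _ ⟨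
    fromℤ -[1+ m ] + fromℤ -[1+ n ]  ∎

  fromℤ-*-homo : ∀ i j → fromℤ (i ℤ.* j) ≈ fromℤ i * fromℤ j
  fromℤ-*-homo i j = begin
    fromℤ (s ◃ ∣ i ∣ ℕ.* ∣ j ∣)                                 ≈⟨ fromℤ-◃ s (∣ i ∣ ℕ.* ∣ j ∣) ⟩
    signed s ((∣ i ∣ ℕ.* ∣ j ∣) · 1#)                           ≈⟨ signed-cong s (×1-homo-* ∣ i ∣ ∣ j ∣) ⟩
    signed s ((∣ i ∣ · 1#) * (∣ j ∣ · 1#))                      ≈⟨ signed-* (sign i) (sign j) _ _ ⟩
    signed (sign i) (∣ i ∣ · 1#) * signed (sign j) (∣ j ∣ · 1#)  ≈⟨ *-cong (fromℤ≈signed i) (fromℤ≈signed j) ⟨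
    fromℤ i * fromℤ j                                           ∎
    where
    s : Sign
    s = sign i Sign.* sign j

  private
    ring⁺ : AlmostCommutativeRing c ℓ
    ring⁺ = ACR.fromCommutativeRing R

    fromℤ-morphism : ℤ.+-*-rawRing -Raw-AlmostCommutative⟶ ring⁺
    fromℤ-morphism = record
      { ⟦_⟧    = fromℤ
      ; +-homo = fromℤ-+-homo
      ; *-homo = fromℤ-*-homo
      ; -‿homo = fromℤ-‿homo
      ; 0-homo = refl
      ; 1-homo = refl
      }

    _≟fromℤ_ : ∀ i j → Maybe (fromℤ i ≈ fromℤ j)
    i ≟fromℤ j with i ℤ.≟ j
    ... | yes ≡.refl = just refl
    ... | no _       = nothing

  open Algebra.Solver.Ring ℤ.+-*-rawRing ring⁺ fromℤ-morphism _≟fromℤ_ public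

module Sums {c ℓ : Level} (R : CommutativeRing c ℓ) where
  open CommutativeRing R hiding (zero)
  open import Algebra.Properties.Semiring.Sum semiring public
    using ( sum; sum-cong-≋; ∑-distrib-+; ∑-comm; sum-remove; sum-replicate-zero
          ; *-distribˡ-sum; *-distribʳ-sum)
  open IntegerCoefficients R using (solve; _:=_; con; _:+_; _:*_; _:-_)
  open import Relation.Binary.Reasoning.Setoid setoid

  𝟙 : ∀ {A : Set} → Dec A → Carrier
  𝟙 a? = if does a? then 1# else 0#

  𝟙-yes : ∀ {A : Set} (a? : Dec A) → A → 𝟙 a? ≈ 1#
  𝟙-yes (yes _) _ = refl
  𝟙-yes (no ¬a) a = ⊥-elim (¬a a)

  𝟙-no : ∀ {A : Set} (a? : Dec A) → ¬ A → 𝟙 a? ≈ 0#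
  𝟙-no (yes a) ¬a = ⊥-elim (¬a a)
  𝟙-no (no _)  _  = refl

  if-then-0#≈𝟙* : ∀ {A : Set} (a? : Dec A) x → (if does a? then x else 0#) ≈ 𝟙 a? * x
  if-then-0#≈𝟙* (yes _) x = sym (*-identityˡ x)
  if-then-0#≈𝟙* (no _)  x = sym (zeroˡ x)

  sum-zero : ∀ {n} {f : Fin n → Carrier} → (∀ i → f i ≈ 0#) → sum f ≈ 0#
  sum-zero {n} f≈0 = trans (sum-cong-≋ f≈0) (sum-replicate-zero n)

  sum-single : ∀ {n} (f : Fin n → Carrier) j → (∀ i → i ≢ j → f i ≈ 0#) → sum f ≈ f j
  sum-single {suc n} f j f≈0 = begin
    sum f                           ≈⟨ sum-remove {i = j} f ⟩
    f j + sum (f ∘ Fin.punchIn j)   ≈⟨ +-congˡ (sum-zero (λ i → f≈0 _ (punchInᵢ≢i j i))) ⟩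
    f j + 0#                        ≈⟨ +-identityʳ _ ⟩
    f j                             ∎

  sum-distrib-sub : ∀ {n} (f g : Fin n → Carrier) → sum (λ i → f i - g i) ≈ sum f - sum g
  sum-distrib-sub {zero}  f g = sym (-‿inverseʳ 0#)
  sum-distrib-sub {suc n} f g = begin
    (f zero - g zero) + sum (λ i → f (suc i) - g (suc i))  ≈⟨ +-congˡ (sum-distrib-sub (f ∘ suc) (g ∘ suc)) ⟩
    (f zero - g zero) + (sum (f ∘ suc) - sum (g ∘ suc))    ≈⟨ swap-middle _ _ _ _ ⟩
    (f zero + sum (f ∘ suc)) - (g zero + sum (g ∘ suc))    ∎
    where
    swap-middle : ∀ a b c d → (a - b) + (c - d) ≈ (a + c) - (b + d)
    swap-middle = solve 4 (λ a b c d → (a :- b) :+ (c :- d) := (a :+ c) :- (b :+ d)) refl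

  ⟨_∣_⟩ : ∀ {n} → (Fin n → Carrier) → (Fin n → Carrier) → Carrier
  ⟨ e ∣ f ⟩ = sum (λ i → e i * f i)

  ⟨∣⟩-congʳ : ∀ {n} (e : Fin n → Carrier) {f g} → (∀ i → f i ≈ g i) → ⟨ e ∣ f ⟩ ≈ ⟨ e ∣ g ⟩
  ⟨∣⟩-congʳ e f≈g = sum-cong-≋ (λ i → *-congˡ (f≈g i))

  ⟨∣⟩-distrib-sub : ∀ {n} (e f g : Fin n → Carrier) → ⟨ e ∣ (λ i → f i - g i) ⟩ ≈ ⟨ e ∣ f ⟩ - ⟨ e ∣ g ⟩
  ⟨∣⟩-distrib-sub e f g = trans (sum-cong-≋ λ i → *-distribˡ-sub (e i) (f i) (g i))
                                (sum-distrib-sub (λ i → e i * f i) (λ i → e i * g i))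
    where
    *-distribˡ-sub : ∀ a b c → a * (b - c) ≈ a * b - a * c
    *-distribˡ-sub = solve 3 (λ a b c → a :* (b :- c) := a :* b :- a :* c) refl

  ⟨∣⟩-sum : ∀ {n m} (e : Fin n → Carrier) (f : Fin m → Fin n → Carrier) →
            ⟨ e ∣ (λ i → sum (λ k → f k i)) ⟩ ≈ sum (λ k → ⟨ e ∣ f k ⟩)
  ⟨∣⟩-sum e f =
    trans (sum-cong-≋ λ i → *-distribˡ-sum (e i) (λ k → f k i)) (∑-comm (λ i k → e i * f k i))

  ⟨∣𝟙≟⟩ : ∀ {n} (e : Fin n → Carrier) j → ⟨ e ∣ (λ i → 𝟙 (i Fin.≟ j)) ⟩ ≈ e j
  ⟨∣𝟙≟⟩ e j = begin
    ⟨ e ∣ (λ i → 𝟙 (i Fin.≟ j)) ⟩  ≈⟨ sum-single _ j vanishes ⟩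
    e j * 𝟙 (j Fin.≟ j)            ≈⟨ *-congˡ (𝟙-yes (j Fin.≟ j) ≡.refl) ⟩
    e j * 1#                       ≈⟨ *-identityʳ _ ⟩
    e j                            ∎
    where
    vanishes : ∀ i → i ≢ j → e i * 𝟙 (i Fin.≟ j) ≈ 0#
    vanishes i i≢j = trans (*-congˡ (𝟙-no (i Fin.≟ j) i≢j)) (zeroʳ _)

  ⟨∣⟩-linear : ∀ {n} (e f g : Fin n → Carrier) a b →
               ⟨ e ∣ (λ i → f i * a + g i * b) ⟩ ≈ ⟨ e ∣ f ⟩ * a + ⟨ e ∣ g ⟩ * b
  ⟨∣⟩-linear e f g a b = begin
    ⟨ e ∣ (λ i → f i * a + g i * b) ⟩
      ≈⟨ sum-cong-≋ (λ i → spread (e i) (f i) (g i) a b) ⟩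
    sum (λ i → (e i * f i) * a + (e i * g i) * b)
      ≈⟨ ∑-distrib-+ (λ i → (e i * f i) * a) (λ i → (e i * g i) * b) ⟩
    sum (λ i → (e i * f i) * a) + sum (λ i → (e i * g i) * b)
      ≈⟨ +-cong (*-distribʳ-sum a (λ i → e i * f i)) (*-distribʳ-sum b (λ i → e i * g i)) ⟨
    ⟨ e ∣ f ⟩ * a + ⟨ e ∣ g ⟩ * b
      ∎
    where
    spread : ∀ e f g a b → e * (f * a + g * b) ≈ (e * f) * a + (e * g) * b
    spread = solve 5 (λ e f g a b → e :* (f :* a :+ g :* b) := (e :* f) :* a :+ (e :* g) :* b) refl

module FieldSums {c ℓ : Level} (F : Field c ℓ) where
  open import Data.Fin.Subset using (∣_∣)
  open Field F hiding (zero)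
  open Sums commutativeRing public
  open import Algebra.Properties.Group +-group using (inverseˡ-unique; x∙y⁻¹≈ε⇒x≈y)
  open IntegerCoefficients commutativeRing using (solve; _:=_; con; _:+_; _:*_; _:-_)
  open import Relation.Binary.Reasoning.Setoid setoid

  ∑≡sum : ∀ {n} (f : Fin n → Carrier) → ∑ F f ≡ sum f
  ∑≡sum {zero}  f = ≡.refl
  ∑≡sum {suc n} f = ≡.cong (λ s → f zero + s) (∑≡sum (f ∘ suc))

  pow-+ : ∀ x m n → pow F x (m ℕ.+ n) ≈ pow F x m * pow F x n
  pow-+ x zero    n = sym (*-identityˡ _)
  pow-+ x (suc m) n = trans (*-congˡ (pow-+ x m n)) (sym (*-assoc _ _ _))

  1+[q-1]qint≈pow : ∀ q n → 1# + (q - 1#) * qint F q n ≈ pow F q n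
  1+[q-1]qint≈pow q zero    = trans (+-congˡ (zeroʳ _)) (+-identityʳ 1#)
  1+[q-1]qint≈pow q (suc n) = begin
    1# + (q - 1#) * (qint F q n + pow F q n)             ≈⟨ regroup q (qint F q n) (pow F q n) ⟩
    (1# + (q - 1#) * qint F q n) + (q - 1#) * pow F q n  ≈⟨ +-congʳ (1+[q-1]qint≈pow q n) ⟩
    pow F q n + (q - 1#) * pow F q n                     ≈⟨ telescope q (pow F q n) ⟩
    q * pow F q n                                        ∎
    where
    regroup : ∀ q Q p → 1# + (q - 1#) * (Q + p) ≈ (1# + (q - 1#) * Q) + (q - 1#) * p
    regroup = solve 3 (λ q Q p → con (+ 1) :+ (q :- con (+ 1)) :* (Q :+ p)
                               := (con (+ 1) :+ (q :- con (+ 1)) :* Q) :+ (q :- con (+ 1)) :* p) refl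
    telescope : ∀ q p → p + (q - 1#) * p ≈ q * p
    telescope = solve 2 (λ q p → p :+ (q :- con (+ 1)) :* p := q :* p) refl

  *-cancelˡ-≈0 : ∀ {x y} → ¬ (x ≈ 0#) → x * y ≈ 0# → y ≈ 0#
  *-cancelˡ-≈0 {x} {y} x≉0 xy≈0 = begin
    y                  ≈⟨ *-identityˡ y ⟨
    1# * y             ≈⟨ *-congʳ (⁻¹-inverse x x≉0) ⟨
    (x * x ⁻¹) * y     ≈⟨ *-congʳ (*-comm x (x ⁻¹)) ⟩
    (x ⁻¹ * x) * y     ≈⟨ *-assoc _ _ _ ⟩
    x ⁻¹ * (x * y)     ≈⟨ *-congˡ xy≈0 ⟩
    x ⁻¹ * 0#          ≈⟨ zeroʳ _ ⟩
    0#                 ∎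

  *-≉0 : ∀ {x y} → ¬ (x ≈ 0#) → ¬ (y ≈ 0#) → ¬ (x * y ≈ 0#)
  *-≉0 x≉0 y≉0 xy≈0 = y≉0 (*-cancelˡ-≈0 x≉0 xy≈0)

  +1≉0 : ∀ {x} → ¬ (x ≈ - 1#) → ¬ (x + 1# ≈ 0#)
  +1≉0 {x} x≉-1 x+1≈0 = x≉-1 (inverseˡ-unique x 1# x+1≈0)

  -1≉0 : ∀ {x} → ¬ (x ≈ 1#) → ¬ (x - 1# ≈ 0#)
  -1≉0 {x} x≉1 x-1≈0 = x≉1 (x∙y⁻¹≈ε⇒x≈y x 1# x-1≈0)

  sum-𝟙∈* : ∀ {n} (S : Subset n) x → sum (λ i → 𝟙 (i ∈? S) * x) ≈ fromℕ F ∣ S ∣ * x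
  sum-𝟙∈* []            x = sym (zeroˡ x)
  sum-𝟙∈* (inside ∷ S)  x = begin
    1# * x + sum (λ i → 𝟙 (i ∈? S) * x)   ≈⟨ +-congˡ (sum-𝟙∈* S x) ⟩
    1# * x + fromℕ F ∣ S ∣ * x            ≈⟨ distribʳ x _ _ ⟨
    (1# + fromℕ F ∣ S ∣) * x              ∎
  sum-𝟙∈* (outside ∷ S) x = trans (+-cong (zeroˡ x) (sum-𝟙∈* S x)) (+-identityˡ _)

  module _ (q : Carrier) {n : ℕ} (δ : Fin n → ℕ) (S : Subset n) where

    ⟨pow∣𝟙∈⟩-sameSide : ∀ {x} → x ∈ S → δ x ≡ 0 → (∀ {i} → i ∈ S → i ≢ x → δ i ≡ 2) →
                        ⟨ pow F q ∘ δ ∣ (λ i → 𝟙 (i ∈? S)) ⟩ ≈ fromℕ F ∣ S ∣ * (q * q) + (1# - q * q)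
    ⟨pow∣𝟙∈⟩-sameSide {x} x∈S δx≡0 δ≡2 = begin
      ⟨ pow F q ∘ δ ∣ (λ i → 𝟙 (i ∈? S)) ⟩
        ≈⟨ sum-cong-≋ pointwise ⟩
      sum (λ i → 𝟙 (i ∈? S) * (q * q) + (1# - q * q) * 𝟙 (i Fin.≟ x))
        ≈⟨ ∑-distrib-+ (λ i → 𝟙 (i ∈? S) * (q * q)) (λ i → (1# - q * q) * 𝟙 (i Fin.≟ x)) ⟩
      sum (λ i → 𝟙 (i ∈? S) * (q * q)) + ⟨ (λ _ → 1# - q * q) ∣ (λ i → 𝟙 (i Fin.≟ x)) ⟩
        ≈⟨ +-cong (sum-𝟙∈* S (q * q)) (⟨∣𝟙≟⟩ _ x) ⟩
      fromℕ F ∣ S ∣ * (q * q) + (1# - q * q)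
        ∎
      where
      pointwise : ∀ i → pow F q (δ i) * 𝟙 (i ∈? S) ≈ 𝟙 (i ∈? S) * (q * q) + (1# - q * q) * 𝟙 (i Fin.≟ x)
      pointwise i with i ∈? S | i Fin.≟ x
      ... | yes _   | yes ≡.refl rewrite δx≡0 = solve 1 (λ q →
            con (+ 1) :* con (+ 1) := con (+ 1) :* (q :* q) :+ (con (+ 1) :- q :* q) :* con (+ 1)) refl q
      ... | yes i∈S | no i≢x rewrite δ≡2 i∈S i≢x = solve 1 (λ q →
            q :* (q :* con (+ 1)) :* con (+ 1)
              := con (+ 1) :* (q :* q) :+ (con (+ 1) :- q :* q) :* con (+ 0)) refl q
      ... | no i∉S  | yes ≡.refl = ⊥-elim (i∉S x∈S)
      ... | no _    | no _ = solve 2 (λ q p →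
            p :* con (+ 0) := con (+ 0) :* (q :* q) :+ (con (+ 1) :- q :* q) :* con (+ 0))
            refl q (pow F q (δ i))

    ⟨pow∣𝟙∈⟩-across : (∀ {i} → i ∈ S → δ i ≡ 1) → ⟨ pow F q ∘ δ ∣ (λ i → 𝟙 (i ∈? S)) ⟩ ≈ fromℕ F ∣ S ∣ * q
    ⟨pow∣𝟙∈⟩-across δ≡1 = trans (sum-cong-≋ pointwise) (sum-𝟙∈* S q)
      where
      pointwise : ∀ i → pow F q (δ i) * 𝟙 (i ∈? S) ≈ 𝟙 (i ∈? S) * q
      pointwise i with i ∈? S
      ... | yes i∈S rewrite δ≡1 i∈S = solve 1 (λ q → q :* con (+ 1) :* con (+ 1) := con (+ 1) :* q) refl q
      ... | no _ = solve 2 (λ q p → p :* con (+ 0) := con (+ 0) :* q) refl q (pow F q (δ i))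

module Walks {N : ℕ} (G : Graph N) where
  open import Data.Nat using (_+_)
  open import Relation.Binary.PropositionalEquality using (refl)
  open Graph G using (Adj)

  private variable
    P Q : Fin N → Set
    u v x z : Fin N
    k l : ℕ

  atStart : WalkIn G P u v k → P u
  atStart (here p)     = p
  atStart (step p _ _) = p

  atEnd : WalkIn G P u v k → P v
  atEnd (here p)     = p
  atEnd (step _ _ W) = atEnd W

  weaken : (∀ t → P t → Q t) → WalkIn G P u v k → WalkIn G Q u v k
  weaken f (here {u} p)     = here (f u p)
  weaken f (step {u} p a W) = step (f u p) a (weaken f W)

  infixr 5 _++ʷ_
  _++ʷ_ : WalkIn G P u v k → WalkIn G P v x l → WalkIn G P u x (k + l)
  here p     ++ʷ W = W
  step p a V ++ʷ W = step p a (V ++ʷ W)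

  snoc : WalkIn G P u v k → Adj v x → P x → WalkIn G P u x (k + 1)
  snoc W a px = W ++ʷ step (atEnd W) a (here px)

  reverseOnto : WalkIn G P u v k → WalkIn G P u x l → WalkIn G P v x (k + l)
  reverseOnto (here p) acc = acc
  reverseOnto {l = l} (step {n = k} p a W) acc =
    subst (WalkIn G _ _ _) (ℕ.+-suc k l) (reverseOnto W (step (atStart W) (Graph.sym G a) acc))

  reverse : WalkIn G P u v k → WalkIn G P v u k
  reverse {k = k} W = subst (WalkIn G _ _ _) (ℕ.+-identityʳ k) (reverseOnto W (here (atStart W)))

  length0⇒≡ : WalkIn G P u v 0 → u ≡ v
  length0⇒≡ (here _) = refl

  length1⇒Adj : WalkIn G P u v 1 → Adj u v
  length1⇒Adj (step _ a (here _)) = a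

  uncons : u ≢ v → WalkIn G P u v k →
           Σ (Fin N) λ p → Σ ℕ λ k′ → k ≡ suc k′ × Adj u p × WalkIn G P p v k′
  uncons u≢v (here _)             = ⊥-elim (u≢v refl)
  uncons _   (step {v = p} _ a W) = p , _ , refl , a , W

  connectedOn-viaHub : (h : Fin N) → (∀ t → Q t → ∃ λ k → WalkIn G Q t h k) → ConnectedOn G Q
  connectedOn-viaHub h toHub u v qu qv with toHub u qu | toHub v qv
  ... | _ , U | _ , V = _ , U ++ʷ reverse V

  _∈ʷ_ : Fin N → WalkIn G P u v k → Set
  x ∈ʷ here {u = u} _     = x ≡ u
  x ∈ʷ step {u = u} _ _ W = x ≡ u ⊎ x ∈ʷ W

  start∈ʷ : (W : WalkIn G P u v k) → u ∈ʷ W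
  start∈ʷ (here _)     = refl
  start∈ʷ (step _ _ _) = inj₁ refl

  restrict : (W : WalkIn G P u v k) → (∀ t → t ∈ʷ W → Q t) → WalkIn G (λ t → P t × Q t) u v k
  restrict (here {u} p)     f = here (p , f u refl)
  restrict (step {u} p a W) f = step (p , f u (inj₁ refl)) a (restrict W (λ t t∈W → f t (inj₂ t∈W)))

  ∈ʷ-restrict : (W : WalkIn G P u v k) (f : ∀ t → t ∈ʷ W → Q t) → x ∈ʷ W → x ∈ʷ restrict W f
  ∈ʷ-restrict (here p)     f x∈W        = x∈W
  ∈ʷ-restrict (step p a W) f (inj₁ x≡u) = inj₁ x≡u
  ∈ʷ-restrict (step p a W) f (inj₂ x∈W) = inj₂ (∈ʷ-restrict W _ x∈W)

  vertices : WalkIn G P u v k → Subset N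
  vertices (here {u} _)     = ⁅ u ⁆
  vertices (step {u} _ _ W) = ⁅ u ⁆ ∪ vertices W

  ∈-vertices⁻ : (W : WalkIn G P u v k) → x ∈ vertices W → x ∈ʷ W
  ∈-vertices⁻ (here {u} _)     x∈W = x∈⁅y⁆⇒x≡y u x∈W
  ∈-vertices⁻ (step {u} _ _ W) x∈W with x∈p∪q⁻ ⁅ u ⁆ (vertices W) x∈W
  ... | inj₁ x∈u = inj₁ (x∈⁅y⁆⇒x≡y u x∈u)
  ... | inj₂ x∈W = inj₂ (∈-vertices⁻ W x∈W)

  ∈-vertices⁺ : (W : WalkIn G P u v k) → x ∈ʷ W → x ∈ vertices W
  ∈-vertices⁺ (here {u} _)     refl        = x∈⁅x⁆ u
  ∈-vertices⁺ (step {u} _ _ W) (inj₁ refl) = x∈p∪q⁺ (inj₁ (x∈⁅x⁆ u))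
  ∈-vertices⁺ (step {u} _ _ W) (inj₂ x∈W)  = x∈p∪q⁺ (inj₂ (∈-vertices⁺ W x∈W))

  SplitAt : (Fin N → Set) → Fin N → Fin N → Fin N → ℕ → Set
  SplitAt P u x v k = Σ ℕ λ k₁ → Σ ℕ λ k₂ → WalkIn G P u x k₁ × WalkIn G P x v k₂ × k₁ + k₂ ≡ k

  splitAt : (W : WalkIn G P u v k) → x ∈ʷ W → SplitAt P u x v k
  splitAt (here p)     refl        = 0 , 0 , here p , here p , refl
  splitAt (step p a W) (inj₁ refl) = 0 , _ , here p , step p a W , refl
  splitAt (step p a W) (inj₂ x∈W) with splitAt W x∈W
  ... | k₁ , k₂ , W₁ , W₂ , eq = suc k₁ , k₂ , step p a W₁ , W₂ , cong suc eq

  avoidOrSplit : (z : Fin N) (W : WalkIn G P u v k) →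
                 WalkIn G (λ t → P t × t ≢ z) u v k ⊎ SplitAt P u z v k
  avoidOrSplit z (here {u} p) with u Fin.≟ z
  ... | yes refl = inj₂ (0 , 0 , here p , here p , refl)
  ... | no u≢z   = inj₁ (here (p , u≢z))
  avoidOrSplit z (step {u} p a W) with u Fin.≟ z
  ... | yes refl = inj₂ (0 , _ , here p , step p a W , refl)
  ... | no u≢z with avoidOrSplit z W
  ...   | inj₁ W′ = inj₁ (step (p , u≢z) a W′)
  ...   | inj₂ (k₁ , k₂ , W₁ , W₂ , eq) = inj₂ (suc k₁ , k₂ , step p a W₁ , W₂ , cong suc eq)

  module _ (S : Subset N) where

    EntersAt : (Fin N → Set) → Fin N → Fin N → Set
    EntersAt P u s = u ≡ s ⊎ Σ (Fin N) λ e → Σ ℕ λ j → WalkIn G (λ t → P t × t ∉ S) u e j × Adj e s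

    firstHit : (W : WalkIn G P u v k) →
      WalkIn G (λ t → P t × t ∉ S) u v k ⊎
      (Σ (Fin N) λ s → s ∈ S × Σ ℕ λ j → j ≤ k × WalkIn G P s v j × EntersAt P u s)
    firstHit (here {u} p) with u ∈? S
    ... | yes u∈S = inj₂ (u , u∈S , 0 , z≤n , here p , inj₁ refl)
    ... | no u∉S  = inj₁ (here (p , u∉S))
    firstHit (step {u} p a W) with u ∈? S
    ... | yes u∈S = inj₂ (u , u∈S , _ , ℕ.≤-refl , step p a W , inj₁ refl)
    ... | no u∉S with firstHit W
    ...   | inj₁ W′ = inj₁ (step (p , u∉S) a W′)
    ...   | inj₂ (s , s∈S , j , j≤ , Wₛ , inj₁ refl) =
              inj₂ (s , s∈S , j , ℕ.m≤n⇒m≤1+n j≤ , Wₛ , inj₂ (u , 0 , here (p , u∉S) , a))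
    ...   | inj₂ (s , s∈S , j , j≤ , Wₛ , inj₂ (e , i , Wₑ , e~s)) =
              inj₂ (s , s∈S , j , ℕ.m≤n⇒m≤1+n j≤ , Wₛ , inj₂ (e , suc i , step (p , u∉S) a Wₑ , e~s))

  ShortestWalk : (Fin N → Set) → Fin N → Fin N → Set
  ShortestWalk P u v = Σ ℕ λ j → WalkIn G P u v j × (∀ i → i < j → ¬ WalkIn G P u v i)

  ¬¬shortestWalk : WalkIn G P u v k → ¬ ¬ ShortestWalk P u v
  ¬¬shortestWalk {P = P} {u} {v} {k} = <-rec (λ k → WalkIn G P u v k → ¬ ¬ ShortestWalk P u v) descend k
    where
    descend : ∀ k → (∀ {i} → i < k → WalkIn G P u v i → ¬ ¬ ShortestWalk P u v) →
              WalkIn G P u v k → ¬ ¬ ShortestWalk P u v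
    descend k shorter W ¬shortest = ¬¬-excluded-middle {A = ∃ λ i → i < k × WalkIn G P u v i} λ
      { (yes (i , i<k , Wᵢ)) → shorter i<k Wᵢ ¬shortest
      ; (no none) → ¬shortest (k , W , λ i i<k Wᵢ → none (i , i<k , Wᵢ)) }

module Block {N : ℕ} (G : Graph N) (S : Subset N) (S-block : IsBlock G S) where
  open import Data.Nat using (_+_)
  open import Relation.Binary.PropositionalEquality using (refl; sym)
  open Graph G using (Adj)
  open Walks G

  private
    +-shortcut< : ∀ p r s₁ s₂ {k₁ k₂ n} → p + suc r ≡ k₁ → s₁ + s₂ ≡ k₂ → k₁ + k₂ ≡ n → p + s₂ < n
    +-shortcut< p r s₁ s₂ refl refl refl =
      ℕ.+-mono-≤ (subst (suc p ≤_) (sym (ℕ.+-suc p r)) (s≤s (ℕ.m≤m+n p r))) (ℕ.m≤n+m s₂ s₁)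

    S-connected : ConnectedOn G (_∈ S)
    S-connected = proj₁ (proj₂ (proj₁ S-block))

    S-noCut : ¬ HasCutVertex G S
    S-noCut = proj₂ (proj₂ (proj₁ S-block))

    S-maximal : ∀ S′ → S ⊆ S′ → Biconn G S′ → S′ ⊆ S
    S-maximal = proj₂ S-block

  Outside : Fin N → Set
  Outside t = t ∉ S

  private
    ∉⇒≢ : ∀ {z t} → z ∈ S → t ∉ S → t ≢ z
    ∉⇒≢ z∈S t∉S refl = t∉S z∈S

  -- An ear of S: a path outside S joining two distinct vertices a and b of S. Adding a shortest
  -- one to S gives a biconnected set, contradicting the maximality of S.
  module ShortestEar {a b c c′ : Fin N} {n : ℕ} (a∈S : a ∈ S) (b∈S : b ∈ S) (a≢b : a ≢ b)
                     (a~c : Adj a c) (W : WalkIn G Outside c c′ n)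
                     (W-shortest : ∀ i → i < n → ¬ WalkIn G Outside c c′ i) (c′~b : Adj c′ b) where

    T : Subset N
    T = S ∪ vertices W

    S⊆T : S ⊆ T
    S⊆T t∈S = x∈p∪q⁺ (inj₁ t∈S)

    Wᵀ : WalkIn G (λ t → Outside t × t ∈ T) c c′ n
    Wᵀ = restrict W (λ t t∈W → x∈p∪q⁺ (inj₂ (∈-vertices⁺ W t∈W)))

    ∈T∖S⇒∈Wᵀ : ∀ {t} → t ∈ T → t ∉ S → t ∈ʷ Wᵀ
    ∈T∖S⇒∈Wᵀ t∈T t∉S with x∈p∪q⁻ S (vertices W) t∈T
    ... | inj₁ t∈S = ⊥-elim (t∉S t∈S)
    ... | inj₂ t∈W = ∈ʷ-restrict W _ (∈-vertices⁻ W t∈W)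

    T-connected : ConnectedOn G (_∈ T)
    T-connected = connectedOn-viaHub a toA
      where
      toA : ∀ t → t ∈ T → ∃ λ k → WalkIn G (_∈ T) t a k
      toA t t∈T with t ∈? S
      ... | yes t∈S = let (k , Wₜ) = S-connected t a t∈S a∈S in k , weaken (λ _ → S⊆T) Wₜ
      ... | no t∉S with splitAt Wᵀ (∈T∖S⇒∈Wᵀ t∈T t∉S)
      ...   | _ , _ , W₁ , _ , _ = _ , snoc (weaken (λ _ → proj₂) (reverse W₁)) (Graph.sym G a~c) (S⊆T a∈S)

    T∖z-connected-∈S : ∀ {z} → z ∈ S → ConnectedOn G (λ t → t ∈ S × t ≢ z) →
                       ConnectedOn G (λ t → t ∈ T × t ≢ z)
    T∖z-connected-∈S {z} z∈S S∖z-connected with z Fin.≟ a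
    ... | no z≢a = connectedOn-viaHub a toA
      where
      toA : ∀ t → t ∈ T × t ≢ z → ∃ λ k → WalkIn G (λ t → t ∈ T × t ≢ z) t a k
      toA t (t∈T , t≢z) with t ∈? S
      ... | yes t∈S = let (k , Wₜ) = S∖z-connected t a (t∈S , t≢z) (a∈S , λ a≡z → z≢a (sym a≡z)) in
                      k , weaken (λ _ (t∈S , t≢z) → S⊆T t∈S , t≢z) Wₜ
      ... | no t∉S with splitAt Wᵀ (∈T∖S⇒∈Wᵀ t∈T t∉S)
      ...   | _ , _ , W₁ , _ , _ =
              _ , snoc (weaken (λ _ (t∉S , t∈T) → t∈T , ∉⇒≢ z∈S t∉S) (reverse W₁))
                       (Graph.sym G a~c) (S⊆T a∈S , λ a≡z → z≢a (sym a≡z))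
    ... | yes refl = connectedOn-viaHub b toB
      where
      toB : ∀ t → t ∈ T × t ≢ a → ∃ λ k → WalkIn G (λ t → t ∈ T × t ≢ a) t b k
      toB t (t∈T , t≢a) with t ∈? S
      ... | yes t∈S = let (k , Wₜ) = S∖z-connected t b (t∈S , t≢a) (b∈S , λ b≡a → a≢b (sym b≡a)) in
                      k , weaken (λ _ (t∈S , t≢a) → S⊆T t∈S , t≢a) Wₜ
      ... | no t∉S with splitAt Wᵀ (∈T∖S⇒∈Wᵀ t∈T t∉S)
      ...   | _ , _ , _ , W₂ , _ =
              _ , snoc (weaken (λ _ (t∉S , t∈T) → t∈T , ∉⇒≢ z∈S t∉S) W₂) c′~b (S⊆T b∈S , λ b≡a → a≢b (sym b≡a))

    -- If z occurred both before and after t on Wᵀ, cutting out the loop through t would give a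
    -- shorter walk from c to c′ outside S.
    noRepeatAround : ∀ {z t p₁ s₁ s₂ k₁ k₂} r → t ≢ z → WalkIn G (λ t → Outside t × t ∈ T) z t r →
                     p₁ + r ≡ k₁ → s₁ + s₂ ≡ k₂ → k₁ + k₂ ≡ n →
                     WalkIn G (λ t → Outside t × t ∈ T) c z p₁ →
                     WalkIn G (λ t → Outside t × t ∈ T) z c′ s₂ → ⊥
    noRepeatAround zero    t≢z Wzt _ _ _ _ _ = t≢z (sym (length0⇒≡ Wzt))
    noRepeatAround {p₁ = p₁} {s₁} {s₂} (suc r) _ _ eq₁ eq₂ eq Wcz Wzc′ =
      W-shortest (p₁ + s₂) (+-shortcut< p₁ r s₁ s₂ eq₁ eq₂ eq) (weaken (λ _ → proj₁) (Wcz ++ʷ Wzc′))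

    T∖z-connected-∉S : ∀ {z} → z ∉ S → ConnectedOn G (λ t → t ∈ T × t ≢ z)
    T∖z-connected-∉S {z} z∉S = connectedOn-viaHub a toA
      where
      S⊆T∖z : ∀ {t} → t ∈ S → t ∈ T × t ≢ z
      S⊆T∖z t∈S = S⊆T t∈S , λ t≡z → z∉S (subst (_∈ S) t≡z t∈S)

      toA : ∀ t → t ∈ T × t ≢ z → ∃ λ k → WalkIn G (λ t → t ∈ T × t ≢ z) t a k
      toA t (t∈T , t≢z) with t ∈? S
      ... | yes t∈S = let (k , Wₜ) = S-connected t a t∈S a∈S in k , weaken (λ _ → S⊆T∖z) Wₜ
      ... | no t∉S with splitAt Wᵀ (∈T∖S⇒∈Wᵀ t∈T t∉S)
      ...   | _ , _ , W₁ , W₂ , eq with avoidOrSplit z W₁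
      ...     | inj₁ W₁′ = _ , snoc (weaken (λ _ ((_ , t∈T) , t≢z) → t∈T , t≢z) (reverse W₁′))
                                    (Graph.sym G a~c) (S⊆T∖z a∈S)
      ...     | inj₂ (_ , r , Wcz , Wzt , eq₁) with avoidOrSplit z W₂
      ...       | inj₁ W₂′ = _ , (snoc (weaken (λ _ ((_ , t∈T) , t≢z) → t∈T , t≢z) W₂′) c′~b (S⊆T∖z b∈S)
                                  ++ʷ weaken (λ _ → S⊆T∖z) (proj₂ (S-connected b a b∈S a∈S)))
      ...       | inj₂ (_ , _ , _ , Wzc′ , eq₂) = ⊥-elim (noRepeatAround r t≢z Wzt eq₁ eq₂ eq Wcz Wzc′)

    T-noCut : ¬ HasCutVertex G T
    T-noCut (z , z∈T , T∖z-disconnected) with z ∈? S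
    ... | yes z∈S = S-noCut (z , z∈S , λ S∖z-connected → T∖z-disconnected (T∖z-connected-∈S z∈S S∖z-connected))
    ... | no z∉S  = T∖z-disconnected (T∖z-connected-∉S z∉S)

    S-notMaximal : ⊥
    S-notMaximal = atStart W (S-maximal T S⊆T ((a , S⊆T a∈S) , T-connected , T-noCut)
                                          (x∈p∪q⁺ (inj₂ (∈-vertices⁺ W (start∈ʷ W)))))

  noEar : ∀ {a b c c′ n} → a ∈ S → b ∈ S → a ≢ b → Adj a c → WalkIn G Outside c c′ n → Adj c′ b → ⊥
  noEar a∈S b∈S a≢b a~c W c′~b =
    ¬¬shortestWalk W (λ (_ , Wₛ , Wₛ-shortest) → ShortestEar.S-notMaximal a∈S b∈S a≢b a~c Wₛ Wₛ-shortest c′~b)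

  biconnected⊆block : ∀ {T u₁ u₂} → Biconn G T → u₁ ∈ S → u₁ ∈ T → u₂ ∈ S → u₂ ∈ T → u₁ ≢ u₂ → T ⊆ S
  biconnected⊆block {T} {u₁} {u₂} T-biconn u₁∈S u₁∈T u₂∈S u₂∈T u₁≢u₂ {z} z∈T with z ∈? S
  ... | yes z∈S = z∈S
  ... | no z∉S  = ⊥-elim (T-noCut (u₁ , u₁∈T , u₁-cuts))
    where
    T-noCut : ¬ HasCutVertex G T
    T-noCut = proj₂ (proj₂ T-biconn)

    z≢ : ∀ {t} → t ∈ S → z ≢ t
    z≢ t∈S z≡t = z∉S (subst (_∈ S) (sym z≡t) t∈S)

    -- z ∉ S is joined to S inside T ∖ u₁, entering S at some s₁ from outside; removing s₁ too,
    -- z must reach S at a second entry point s₂ ≠ s₁, and the two routes form an ear of S.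
    s₁-cuts : ∀ {s₁ e₁ i₁} → s₁ ∈ S → s₁ ≢ u₁ → WalkIn G (λ t → (t ∈ T × t ≢ u₁) × Outside t) z e₁ i₁ →
              Adj e₁ s₁ → ¬ ConnectedOn G (λ t → t ∈ T × t ≢ s₁)
    s₁-cuts {s₁} s₁∈S s₁≢u₁ W₁ e₁~s₁ T∖s₁-connected
      with firstHit S (proj₂ (T∖s₁-connected z u₁ (z∈T , z≢ s₁∈S) (u₁∈T , λ u₁≡s₁ → s₁≢u₁ (sym u₁≡s₁))))
    ... | inj₁ W′ = proj₂ (atEnd W′) u₁∈S
    ... | inj₂ (s₂ , s₂∈S , _ , _ , _ , inj₁ z≡s₂) = z≢ s₂∈S z≡s₂
    ... | inj₂ (s₂ , s₂∈S , _ , _ , Wₛ₂ , inj₂ (e₂ , _ , W₂ , e₂~s₂)) =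
          noEar s₁∈S s₂∈S (λ s₁≡s₂ → proj₂ (atStart Wₛ₂) (sym s₁≡s₂)) (Graph.sym G e₁~s₁)
                (weaken (λ _ → proj₂) (reverse W₁) ++ʷ weaken (λ _ → proj₂) W₂) e₂~s₂

    u₁-cuts : ¬ ConnectedOn G (λ t → t ∈ T × t ≢ u₁)
    u₁-cuts T∖u₁-connected
      with firstHit S (proj₂ (T∖u₁-connected z u₂ (z∈T , z≢ u₁∈S) (u₂∈T , λ u₂≡u₁ → u₁≢u₂ (sym u₂≡u₁))))
    ... | inj₁ W′ = proj₂ (atEnd W′) u₂∈S
    ... | inj₂ (s₁ , s₁∈S , _ , _ , _ , inj₁ z≡s₁) = z≢ s₁∈S z≡s₁
    ... | inj₂ (s₁ , s₁∈S , _ , _ , Wₛ₁ , inj₂ (e₁ , _ , W₁ , e₁~s₁)) =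
          T-noCut (s₁ , proj₁ (atStart Wₛ₁) , s₁-cuts s₁∈S (proj₂ (atStart Wₛ₁)) W₁ e₁~s₁)

module _ {N : ℕ} (G : Graph N) where
  open import Relation.Binary.PropositionalEquality using (refl)
  open Graph G using (Adj)

  -- Enlarge S as long as a larger biconnected set exists (⊂ is well-founded on subsets); whether
  -- one exists is not decidable, hence the double negation.
  ¬¬block⊇ : ∀ S → Biconn G S → ¬ ¬ (Σ (Subset N) λ S′ → S ⊆ S′ × IsBlock G S′)
  ¬¬block⊇ = All.wfRec ⊃-wellFounded _ _ extend
    where
    extend : ∀ S → (∀ {S′} → S ⊂ S′ → Biconn G S′ → ¬ ¬ (Σ (Subset N) λ S″ → S′ ⊆ S″ × IsBlock G S″)) →
             Biconn G S → ¬ ¬ (Σ (Subset N) λ S′ → S ⊆ S′ × IsBlock G S′)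
    extend S larger S-biconn noBlock =
      ¬¬-excluded-middle {A = Σ (Subset N) λ S′ → S ⊂ S′ × Biconn G S′} λ
        { (yes (S′ , S⊂S′ , S′-biconn)) →
            larger S⊂S′ S′-biconn λ (S″ , S′⊆S″ , S″-block) →
              noBlock (S″ , ⊆-trans (proj₁ S⊂S′) S′⊆S″ , S″-block)
        ; (no noLarger) → noBlock (S , ⊆-refl , S-biconn , maximal noLarger) }
      where
      maximal : ¬ (Σ (Subset N) λ S′ → S ⊂ S′ × Biconn G S′) → ∀ S′ → S ⊆ S′ → Biconn G S′ → S′ ⊆ S
      maximal noLarger S′ S⊆S′ S′-biconn {x} x∈S′ with x ∈? S
      ... | yes x∈S = x∈S
      ... | no x∉S  = ⊥-elim (noLarger (S′ , (S⊆S′ , x , x∈S′ , x∉S) , S′-biconn))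

  module _ {v p : Fin N} (v~p : Adj v p) where

    private
      ∈edge⁻ : ∀ {x} → x ∈ ⁅ v ⁆ ∪ ⁅ p ⁆ → x ≡ v ⊎ x ≡ p
      ∈edge⁻ x∈E with x∈p∪q⁻ ⁅ v ⁆ ⁅ p ⁆ x∈E
      ... | inj₁ x∈v = inj₁ (x∈⁅y⁆⇒x≡y v x∈v)
      ... | inj₂ x∈p = inj₂ (x∈⁅y⁆⇒x≡y p x∈p)

      v∈edge : v ∈ ⁅ v ⁆ ∪ ⁅ p ⁆
      v∈edge = x∈p∪q⁺ (inj₁ (x∈⁅x⁆ v))

      p∈edge : p ∈ ⁅ v ⁆ ∪ ⁅ p ⁆
      p∈edge = x∈p∪q⁺ (inj₂ (x∈⁅x⁆ p))

    edge-biconnected : Biconn G (⁅ v ⁆ ∪ ⁅ p ⁆)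
    edge-biconnected = (v , v∈edge) , connected , noCut
      where
      connected : ConnectedOn G (_∈ ⁅ v ⁆ ∪ ⁅ p ⁆)
      connected x y x∈E y∈E with ∈edge⁻ x∈E | ∈edge⁻ y∈E
      ... | inj₁ refl | inj₁ refl = 0 , here v∈edge
      ... | inj₁ refl | inj₂ refl = 1 , step v∈edge v~p (here p∈edge)
      ... | inj₂ refl | inj₁ refl = 1 , step p∈edge (Graph.sym G v~p) (here v∈edge)
      ... | inj₂ refl | inj₂ refl = 0 , here p∈edge

      atMostOneLeft : ∀ {x y z} → x ∈ ⁅ v ⁆ ∪ ⁅ p ⁆ → y ∈ ⁅ v ⁆ ∪ ⁅ p ⁆ → z ∈ ⁅ v ⁆ ∪ ⁅ p ⁆ →
                      x ≢ z → y ≢ z → x ≡ y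
      atMostOneLeft x∈E y∈E z∈E x≢z y≢z with ∈edge⁻ x∈E | ∈edge⁻ y∈E | ∈edge⁻ z∈E
      ... | inj₁ refl | inj₁ refl | _         = refl
      ... | inj₂ refl | inj₂ refl | _         = refl
      ... | inj₁ refl | inj₂ refl | inj₁ refl = ⊥-elim (x≢z refl)
      ... | inj₁ refl | inj₂ refl | inj₂ refl = ⊥-elim (y≢z refl)
      ... | inj₂ refl | inj₁ refl | inj₁ refl = ⊥-elim (y≢z refl)
      ... | inj₂ refl | inj₁ refl | inj₂ refl = ⊥-elim (x≢z refl)

      noCut : ¬ HasCutVertex G (⁅ v ⁆ ∪ ⁅ p ⁆)
      noCut (z , z∈E , disconnected) = disconnected λ x y (x∈E , x≢z) (y∈E , y≢z) →
        0 , subst (λ y → WalkIn G _ x y 0) (atMostOneLeft x∈E y∈E z∈E x≢z y≢z) (here (x∈E , x≢z))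

module Distance {N : ℕ} (G : Graph N) (d : Fin N → Fin N → ℕ) (isDistance : IsDistance G d) where
  open import Data.Nat using (_+_)
  open import Relation.Binary.PropositionalEquality using (sym; trans)
  open Graph G using (Adj)
  open Walks G

  geodesic : ∀ u v → WalkIn G (AllV G) u v (d u v)
  geodesic u v = proj₁ (isDistance u v)

  d-minimal : ∀ {P u v k} → WalkIn G P u v k → d u v ≤ k
  d-minimal {u = u} {v} W = proj₂ (isDistance u v) _ (weaken (λ t _ → t) W)

  d-triangle : ∀ u v x → d u x ≤ d u v + d v x
  d-triangle u v x = d-minimal (geodesic u v ++ʷ geodesic v x)

  d-sym : ∀ u v → d u v ≡ d v u
  d-sym u v = ℕ.≤-antisym (d-minimal (reverse (geodesic v u))) (d-minimal (reverse (geodesic u v)))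

  d-refl : ∀ u → d u u ≡ 0
  d-refl u = ℕ.n≤0⇒n≡0 (d-minimal (here {P = AllV G} u))

  d≡0⇒≡ : ∀ {u v} → d u v ≡ 0 → u ≡ v
  d≡0⇒≡ {u} {v} eq = length0⇒≡ (subst (WalkIn G _ u v) eq (geodesic u v))

  d≡1⇒Adj : ∀ {u v} → d u v ≡ 1 → Adj u v
  d≡1⇒Adj {u} {v} eq = length1⇒Adj (subst (WalkIn G _ u v) eq (geodesic u v))

  Adj⇒d≤1 : ∀ {u v} → Adj u v → d u v ≤ 1
  Adj⇒d≤1 {u} {v} u~v = d-minimal (step {P = AllV G} u u~v (here v))

  Adj⇒d≡1 : ∀ {u v} → Adj u v → d u v ≡ 1
  Adj⇒d≡1 {u} {v} u~v = ℕ.≤-antisym (Adj⇒d≤1 u~v)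
    (ℕ.n≢0⇒n>0 λ d≡0 → Graph.irrefl G (subst (Adj u) (sym (d≡0⇒≡ d≡0)) u~v))

  module _ {X Y : Subset N} (XY-complete : CompleteBipartite G X Y) where

    private
      y₀ : Fin N
      y₀ = proj₁ (proj₁ (proj₂ XY-complete))

      y₀∈Y : y₀ ∈ Y
      y₀∈Y = proj₂ (proj₁ (proj₂ XY-complete))

      X-Y-adjacent : ∀ {x y} → x ∈ X → y ∈ Y → Adj x y
      X-Y-adjacent = proj₁ (proj₂ (proj₂ (proj₂ XY-complete))) _ _

      X-independent : ∀ x x′ → x ∈ X → x′ ∈ X → ¬ Adj x x′
      X-independent = proj₁ (proj₂ (proj₂ (proj₂ (proj₂ XY-complete))))

    d-across : ∀ {x y} → x ∈ X → y ∈ Y → d x y ≡ 1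
    d-across x∈X y∈Y = Adj⇒d≡1 (X-Y-adjacent x∈X y∈Y)

    d-sameSide : ∀ {x x′} → x ∈ X → x′ ∈ X → x ≢ x′ → d x x′ ≡ 2
    d-sameSide {x} {x′} x∈X x′∈X x≢x′ = ℕ.≤-antisym
      (d-minimal (step {P = AllV G} x (X-Y-adjacent x∈X y₀∈Y)
                   (step y₀ (Graph.sym G (X-Y-adjacent x′∈X y₀∈Y)) (here x′))))
      (ℕ.≤∧≢⇒< (ℕ.n≢0⇒n>0 (λ d≡0 → x≢x′ (d≡0⇒≡ d≡0)))
               (λ 1≡d → X-independent x x′ x∈X x′∈X (d≡1⇒Adj (sym 1≡d))))

    closerNeighbour : ∀ {v g} → v ∈ X → g ∈ X ⊎ g ∈ Y → v ≢ g →
                      Σ (Fin N) λ y → (y ∈ X ⊎ y ∈ Y) × Adj v y × d y g < d v g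
    closerNeighbour {v} {g} v∈X (inj₁ g∈X) v≢g =
      y₀ , inj₂ y₀∈Y , X-Y-adjacent v∈X y₀∈Y ,
      subst₂ _<_ (sym (trans (d-sym y₀ g) (d-across g∈X y₀∈Y))) (sym (d-sameSide v∈X g∈X v≢g)) ℕ.≤-refl
    closerNeighbour {v} {g} v∈X (inj₂ g∈Y) v≢g =
      g , inj₂ g∈Y , X-Y-adjacent v∈X g∈Y ,
      subst₂ _<_ (sym (d-refl g)) (sym (d-across v∈X g∈Y)) ℕ.≤-refl

completeBipartite-swap : ∀ {N} {G : Graph N} {X Y : Subset N} →
                         CompleteBipartite G X Y → CompleteBipartite G Y X
completeBipartite-swap {G = G} (x₀ , y₀ , disjoint , adjacent , X-independent , Y-independent) =
  y₀ , x₀ , (λ v v∈Y v∈X → disjoint v v∈X v∈Y) , (λ y x y∈Y x∈X → Graph.sym G (adjacent x y x∈X y∈Y)) ,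
  Y-independent , X-independent

module RootedBlocks {N : ℕ} {G : Graph N} (B : BiBlock G)
                    (d : Fin N → Fin N → ℕ) (isDistance : IsDistance G d) (w : Fin N) where
  open import Data.Nat using (_+_)
  open import Relation.Binary.PropositionalEquality using (refl; sym; trans)
  open Graph G using (Adj)
  open Walks G
  open Distance G d isDistance
  open BiBlock B

  D : Fin N → ℕ
  D t = d t w

  block : Fin r → Subset N
  block k = X k ∪ Y k

  private
    someVertex : ∀ k → ∃ λ x → x ∈ block k
    someVertex k = let (x , x∈X) = proj₁ (complete k) in x , x∈p∪q⁺ (inj₁ x∈X)

  gate : Fin r → Fin N
  gate k = argmin D (proj₁ (someVertex k)) (filter (_∈? block k) (allFin N))

  gate∈block : ∀ k → gate k ∈ block k
  gate∈block k = argmin-all D (proj₂ (someVertex k)) (all-filter (_∈? block k) (allFin N))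

  gate-nearest : ∀ k {y} → y ∈ block k → D (gate k) ≤ D y
  gate-nearest k {y} y∈B =
    lookup (f[argmin]≤f[xs] (proj₁ (someVertex k)) _) (∈-filter⁺ (_∈? block k) (∈-allFin y) y∈B)

  gate-root : ∀ k → w ∈ block k → gate k ≡ w
  gate-root k w∈B = d≡0⇒≡ (ℕ.n≤0⇒n≡0 (subst (D (gate k) ≤_) (d-refl w) (gate-nearest k w∈B)))

  nonGate≢root : ∀ k {v} → v ∈ block k → v ≢ gate k → v ≢ w
  nonGate≢root k v∈B v≢g refl = v≢g (sym (gate-root k v∈B))

  -- The walk from p either re-enters the block at some s ≠ v, or reaches w outside it; then the
  -- geodesic from the gate to w leaves the block at once (no vertex of it is nearer to w) and the
  -- two walks join v to the gate outside the block. Either way the block would have an ear.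
  noShortcutThroughExit : ∀ k {v p j} → v ∈ block k → v ≢ gate k → p ∉ block k → Adj v p →
                          WalkIn G (AllV G) p w j → j < D v → ⊥
  noShortcutThroughExit k {v} v∈B v≢g p∉B v~p Wₚ j<Dv with firstHit (block k) Wₚ
  ... | inj₂ (s , s∈B , _ , _ , _ , inj₁ p≡s) = p∉B (subst (_∈ block k) (sym p≡s) s∈B)
  ... | inj₂ (s , s∈B , _ , j′≤j , Wₛ , inj₂ (e , _ , Wₑ , e~s)) =
        Block.noEar G (block k) (isBlock k) v∈B s∈B v≢s v~p (weaken (λ _ → proj₂) Wₑ) e~s
    where
    v≢s : v ≢ s
    v≢s refl = ℕ.<-irrefl refl (ℕ.≤-<-trans (ℕ.≤-trans (d-minimal Wₛ) j′≤j) j<Dv)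
  ... | inj₁ Wₒ with uncons (λ g≡w → proj₂ (atEnd Wₒ) (subst (_∈ block k) g≡w (gate∈block k)))
                            (geodesic (gate k) w)
  ...   | b , k′ , Dg≡1+k′ , g~b , W_b with firstHit (block k) W_b
  ...     | inj₂ (s , s∈B , _ , j≤k′ , Wₛ , _) =
            ℕ.<-irrefl refl (ℕ.<-≤-trans (s≤s (ℕ.≤-trans (d-minimal Wₛ) j≤k′))
                                          (subst (_≤ D s) Dg≡1+k′ (gate-nearest k s∈B)))
  ...     | inj₁ W_b′ = Block.noEar G (block k) (isBlock k) v∈B (gate∈block k) v≢g v~p
                          (weaken (λ _ → proj₂) Wₒ ++ʷ reverse (weaken (λ _ → proj₂) W_b′)) (Graph.sym G g~b)

  private
    viaGate-≥ : ∀ k n v → D v ≡ n → v ∈ block k → d v (gate k) + D (gate k) ≤ D v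
    viaGate-≥ k = <-rec _ descend
      where
      descend : ∀ n → (∀ {m} → m < n → ∀ v → D v ≡ m → v ∈ block k → d v (gate k) + D (gate k) ≤ D v) →
                ∀ v → D v ≡ n → v ∈ block k → d v (gate k) + D (gate k) ≤ D v
      descend n shorter v Dv≡n v∈B with v Fin.≟ gate k
      ... | yes refl = subst (λ t → t + D v ≤ D v) (sym (d-refl v)) ℕ.≤-refl
      ... | no v≢g with uncons (nonGate≢root k v∈B v≢g) (geodesic v w)
      ...   | p , k′ , Dv≡1+k′ , v~p , Wₚ with p ∈? block k
      ...     | no p∉B =
              ⊥-elim (noShortcutThroughExit k v∈B v≢g p∉B v~p Wₚ (subst (k′ <_) (sym Dv≡1+k′) ℕ.≤-refl))
      ...     | yes p∈B = begin
        d v (gate k) + D (gate k)        ≤⟨ ℕ.+-monoˡ-≤ (D (gate k)) (ℕ.≤-trans (d-triangle v p (gate k))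
                                                                    (ℕ.+-monoˡ-≤ _ (Adj⇒d≤1 v~p))) ⟩
        suc (d p (gate k) + D (gate k))  ≤⟨ s≤s (shorter Dp<n p refl p∈B) ⟩
        suc (D p)                        ≤⟨ s≤s Dp≤k′ ⟩
        suc k′                           ≡⟨ sym Dv≡1+k′ ⟩
        D v                              ∎
        where
        open ℕ.≤-Reasoning
        Dp≤k′ : D p ≤ k′
        Dp≤k′ = d-minimal Wₚ
        Dp<n : D p < n
        Dp<n = subst (D p <_) (trans (sym Dv≡1+k′) Dv≡n) (s≤s Dp≤k′)

  distance-viaGate : ∀ k {v} → v ∈ block k → D v ≡ d v (gate k) + D (gate k)
  distance-viaGate k {v} v∈B = ℕ.≤-antisym (d-triangle v (gate k) w) (viaGate-≥ k (D v) v refl v∈B)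

  nonGateBlock : ∀ {v} → v ≢ w → Σ (Fin r) λ k → v ∈ block k × v ≢ gate k
  nonGateBlock {v} v≢w with uncons v≢w (geodesic v w)
  ... | p , k′ , Dv≡1+k′ , v~p , Wₚ =
    decidable-stable (any? λ k → (v ∈? block k) ×-dec ¬? (v Fin.≟ gate k)) λ noneFound →
      ¬¬block⊇ G _ (edge-biconnected G v~p) λ (S , edge⊆S , S-block) →
        noneFound (edgeBlock (allBlocks S S-block) edge⊆S)
    where
    edgeBlock : ∀ {S} → (∃ λ k → S ≡ block k) → ⁅ v ⁆ ∪ ⁅ p ⁆ ⊆ S → Σ (Fin r) λ k → v ∈ block k × v ≢ gate k
    edgeBlock (k , refl) edge⊆B = k , edge⊆B (x∈p∪q⁺ (inj₁ (x∈⁅x⁆ v))) , v≢g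
      where
      Dg<Dv : D (gate k) < D v
      Dg<Dv = ℕ.≤-<-trans (gate-nearest k (edge⊆B (x∈p∪q⁺ (inj₂ (x∈⁅x⁆ p)))))
                          (subst (D p <_) (sym Dv≡1+k′) (s≤s (d-minimal Wₚ)))
      v≢g : v ≢ gate k
      v≢g refl = ℕ.<-irrefl refl Dg<Dv

  private
    neighbourCloserToGate⇒closerToRoot : ∀ l {v} → v ∈ block l →
      Σ (Fin N) (λ y → (y ∈ X l ⊎ y ∈ Y l) × Adj v y × d y (gate l) < d v (gate l)) →
      Σ (Fin N) λ y → y ∈ block l × Adj v y × D y < D v
    neighbourCloserToGate⇒closerToRoot l v∈B (y , y∈X⊎Y , v~y , closer) =
      y , x∈p∪q⁺ y∈X⊎Y , v~y ,
      ℕ.≤-<-trans (d-triangle y (gate l) w)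
                  (subst (d y (gate l) + D (gate l) <_) (sym (distance-viaGate l v∈B))
                         (ℕ.+-monoˡ-< (D (gate l)) closer))

    closerToRoot : ∀ l {v} → v ∈ block l → v ≢ gate l →
                   Σ (Fin N) λ y → y ∈ block l × Adj v y × D y < D v
    closerToRoot l v∈B v≢g with x∈p∪q⁻ (X l) (Y l) v∈B
    ... | inj₁ v∈X = neighbourCloserToGate⇒closerToRoot l v∈B
                       (closerNeighbour (complete l) v∈X (x∈p∪q⁻ _ _ (gate∈block l)) v≢g)
    ... | inj₂ v∈Y with closerNeighbour (completeBipartite-swap {G = G} (complete l)) v∈Y
                          (swap (x∈p∪q⁻ _ _ (gate∈block l))) v≢g
    ...   | y , y∈Y⊎X , v~y , closer =
            neighbourCloserToGate⇒closerToRoot l v∈B (y , swap y∈Y⊎X , v~y , closer)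

  nonGateBlock-unique : ∀ {v k l} → v ∈ block k → v ≢ gate k → v ∈ block l → v ≢ gate l → k ≡ l
  nonGateBlock-unique {v} {k} {l} v∈Bₖ v≢gₖ v∈Bₗ v≢gₗ with closerToRoot l v∈Bₗ v≢gₗ
  ... | y , y∈Bₗ , v~y , Dy<Dv with y ∈? block k
  ...   | no y∉Bₖ = ⊥-elim (noShortcutThroughExit k v∈Bₖ v≢gₖ y∉Bₖ v~y (geodesic y w) Dy<Dv)
  ...   | yes y∈Bₖ = distinct k l (⊆-antisym Bₖ⊆Bₗ Bₗ⊆Bₖ)
    where
    v≢y : v ≢ y
    v≢y refl = Graph.irrefl G v~y
    Bₗ⊆Bₖ : block l ⊆ block k
    Bₗ⊆Bₖ = Block.biconnected⊆block G (block k) (isBlock k) (proj₁ (isBlock l)) v∈Bₖ v∈Bₗ y∈Bₖ y∈Bₗ v≢y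
    Bₖ⊆Bₗ : block k ⊆ block l
    Bₖ⊆Bₗ = proj₂ (isBlock l) (block k) Bₗ⊆Bₖ (proj₁ (isBlock k))

module XVectorPairing
  {c ℓ : Level} (F : Field c ℓ) {N : ℕ} {G : Graph N} (B : BiBlock G)
  (d : Fin N → Fin N → ℕ) (isDistance : IsDistance G d) (w : Fin N) (q : Field.Carrier F)
  (nondegenerate : ∀ k → ¬ (Field._≈_ F (Field._*_ F (Field._+_ F q (Field.1# F)) (Δ F B q k)) (Field.0# F)))
  where
  open Field F hiding (zero)
  open FieldSums F
  open IntegerCoefficients commutativeRing using (solve; _:=_; con; _:+_; _:*_; _:-_)
  open Distance G d isDistance
  open RootedBlocks B d isDistance w
  open BiBlock B
  open import Relation.Binary.Reasoning.Setoid setoid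

  e : Fin N → Carrier
  e v = pow F q (D v)

  scale : Fin r → Carrier
  scale k = ((q + 1#) * Δ F B q k) ⁻¹

  aX aY : Fin r → Carrier
  aX k = q * (fromℕ F (n k) - 1#) - 1#
  aY k = q * (fromℕ F (m k) - 1#) - 1#

  weight : Fin r → Fin N → Carrier
  weight k v = 𝟙 (v ∈? X k) * (aX k * scale k) + 𝟙 (v ∈? Y k) * (aY k * scale k)

  xvec≈ : ∀ v → xvec F B q v ≈ sum (λ k → weight k v) - (sum (λ k → 𝟙 (v ∈? block k)) - 1#)
  xvec≈ v = begin
    xvec F B q v
      ≡⟨ ≡.cong₂ (λ a b → a - (b - 1#)) (≡.cong₂ _+_ (∑≡sum ifX) (∑≡sum ifY))
                 (∑≡sum (λ k → 𝟙 (v ∈? block k))) ⟩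
    sum ifX + sum ifY - (sum (λ k → 𝟙 (v ∈? block k)) - 1#)
      ≈⟨ +-congʳ (∑-distrib-+ ifX ifY) ⟨
    sum (λ k → ifX k + ifY k) - (sum (λ k → 𝟙 (v ∈? block k)) - 1#)
      ≈⟨ +-congʳ (sum-cong-≋ λ k → +-cong (if-then-0#≈𝟙* (v ∈? X k) _) (if-then-0#≈𝟙* (v ∈? Y k) _)) ⟩
    sum (λ k → weight k v) - (sum (λ k → 𝟙 (v ∈? block k)) - 1#) ∎
    where
    ifX ifY : Fin r → Carrier
    ifX k = if does (v ∈? X k) then aX k * scale k else 0#
    ifY k = if does (v ∈? Y k) then aY k * scale k else 0#

  private
    balanced : ∀ k {ΣX ΣY} → ΣX * aX k + ΣY * aY k ≈ (q + 1#) * Δ F B q k →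
               ΣX * (aX k * scale k) + ΣY * (aY k * scale k) ≈ 1#
    balanced k {ΣX} {ΣY} sides≈ = begin
      ΣX * (aX k * scale k) + ΣY * (aY k * scale k)  ≈⟨ factor ΣX (aX k) ΣY (aY k) (scale k) ⟩
      (ΣX * aX k + ΣY * aY k) * scale k              ≈⟨ *-congʳ sides≈ ⟩
      ((q + 1#) * Δ F B q k) * scale k               ≈⟨ ⁻¹-inverse _ (nondegenerate k) ⟩
      1#                                             ∎
      where
      factor : ∀ x a y b s → x * (a * s) + y * (b * s) ≈ (x * a + y * b) * s
      factor = solve 5 (λ x a y b s → x :* (a :* s) :+ y :* (b :* s) := (x :* a :+ y :* b) :* s) refl

    gateInX-identity : ∀ k → (fromℕ F (m k) * (q * q) + (1# - q * q)) * aX k + (fromℕ F (n k) * q) * aY k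
                             ≈ (q + 1#) * Δ F B q k
    gateInX-identity k = solve 3 (λ q M N →
      (M :* (q :* q) :+ (con (+ 1) :- q :* q)) :* (q :* (N :- con (+ 1)) :- con (+ 1))
        :+ (N :* q) :* (q :* (M :- con (+ 1)) :- con (+ 1))
      := (q :+ con (+ 1)) :* ((q :* q) :* ((M :- con (+ 1)) :* (N :- con (+ 1))) :- con (+ 1))) refl
      q (fromℕ F (m k)) (fromℕ F (n k))

    gateInY-identity : ∀ k → (fromℕ F (m k) * q) * aX k + (fromℕ F (n k) * (q * q) + (1# - q * q)) * aY k
                             ≈ (q + 1#) * Δ F B q k
    gateInY-identity k = solve 3 (λ q M N →
      (M :* q) :* (q :* (N :- con (+ 1)) :- con (+ 1))
        :+ (N :* (q :* q) :+ (con (+ 1) :- q :* q)) :* (q :* (M :- con (+ 1)) :- con (+ 1))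
      := (q :+ con (+ 1)) :* ((q :* q) :* ((M :- con (+ 1)) :* (N :- con (+ 1))) :- con (+ 1))) refl
      q (fromℕ F (m k)) (fromℕ F (n k))

    gatePower : Fin r → Fin N → Carrier
    gatePower k v = pow F q (d v (gate k))

    ⟨gatePower∣sides⟩ : ∀ k → ⟨ gatePower k ∣ (λ v → 𝟙 (v ∈? X k)) ⟩ * aX k
                              + ⟨ gatePower k ∣ (λ v → 𝟙 (v ∈? Y k)) ⟩ * aY k ≈ (q + 1#) * Δ F B q k
    ⟨gatePower∣sides⟩ k with x∈p∪q⁻ (X k) (Y k) (gate∈block k)
    ... | inj₁ g∈X = trans (+-cong (*-congʳ X-sum) (*-congʳ Y-sum)) (gateInX-identity k)
      where
      X-sum : ⟨ gatePower k ∣ (λ v → 𝟙 (v ∈? X k)) ⟩ ≈ fromℕ F (m k) * (q * q) + (1# - q * q)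
      X-sum = ⟨pow∣𝟙∈⟩-sameSide q (λ v → d v (gate k)) (X k) g∈X (d-refl (gate k))
                (λ i∈X i≢g → d-sameSide (complete k) i∈X g∈X i≢g)
      Y-sum : ⟨ gatePower k ∣ (λ v → 𝟙 (v ∈? Y k)) ⟩ ≈ fromℕ F (n k) * q
      Y-sum = ⟨pow∣𝟙∈⟩-across q (λ v → d v (gate k)) (Y k)
                (λ {i} i∈Y → ≡.trans (d-sym i (gate k)) (d-across (complete k) g∈X i∈Y))
    ... | inj₂ g∈Y = trans (+-cong (*-congʳ X-sum) (*-congʳ Y-sum)) (gateInY-identity k)
      where
      X-sum : ⟨ gatePower k ∣ (λ v → 𝟙 (v ∈? X k)) ⟩ ≈ fromℕ F (m k) * q
      X-sum = ⟨pow∣𝟙∈⟩-across q (λ v → d v (gate k)) (X k) (λ i∈X → d-across (complete k) i∈X g∈Y)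
      Y-sum : ⟨ gatePower k ∣ (λ v → 𝟙 (v ∈? Y k)) ⟩ ≈ fromℕ F (n k) * (q * q) + (1# - q * q)
      Y-sum = ⟨pow∣𝟙∈⟩-sameSide q (λ v → d v (gate k)) (Y k) g∈Y (d-refl (gate k))
                (λ i∈Y i≢g → d-sameSide (completeBipartite-swap {G = G} (complete k)) i∈Y g∈Y i≢g)

    ⟨gatePower∣weight⟩ : ∀ k → ⟨ gatePower k ∣ weight k ⟩ ≈ 1#
    ⟨gatePower∣weight⟩ k =
      trans (⟨∣⟩-linear (gatePower k) (λ v → 𝟙 (v ∈? X k)) (λ v → 𝟙 (v ∈? Y k)) _ _)
            (balanced k (⟨gatePower∣sides⟩ k))

    weight-outside : ∀ k {v} → v ∉ block k → weight k v ≈ 0#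
    weight-outside k {v} v∉B with v ∈? X k | v ∈? Y k
    ... | yes v∈X | _       = ⊥-elim (v∉B (x∈p∪q⁺ (inj₁ v∈X)))
    ... | no _    | yes v∈Y = ⊥-elim (v∉B (x∈p∪q⁺ (inj₂ v∈Y)))
    ... | no _    | no _    = trans (+-cong (zeroˡ _) (zeroˡ _)) (+-identityʳ 0#)

  ⟨e∣weight⟩ : ∀ k → ⟨ e ∣ weight k ⟩ ≈ e (gate k)
  ⟨e∣weight⟩ k = begin
    ⟨ e ∣ weight k ⟩                                ≈⟨ sum-cong-≋ throughGate ⟩
    sum (λ v → e g * (gatePower k v * weight k v))  ≈⟨ *-distribˡ-sum (e g) (λ v → gatePower k v * weight k v) ⟨
    e g * ⟨ gatePower k ∣ weight k ⟩                ≈⟨ *-congˡ (⟨gatePower∣weight⟩ k) ⟩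
    e g * 1#                                        ≈⟨ *-identityʳ _ ⟩
    e g                                             ∎
    where
    g : Fin N
    g = gate k
    throughGate : ∀ v → e v * weight k v ≈ e g * (gatePower k v * weight k v)
    throughGate v with v ∈? block k
    ... | yes v∈B = begin
      e v * weight k v                      ≡⟨ ≡.cong (λ n → pow F q n * weight k v) (distance-viaGate k v∈B) ⟩
      pow F q (d v g ℕ.+ D g) * weight k v  ≈⟨ *-congʳ (pow-+ q (d v g) (D g)) ⟩
      (gatePower k v * e g) * weight k v    ≈⟨ solve 3 (λ a b c → (a :* b) :* c := b :* (a :* c)) refl _ _ _ ⟩
      e g * (gatePower k v * weight k v)    ∎
    ... | no v∉B = begin
      e v * weight k v                      ≈⟨ *-congˡ (weight-outside k v∉B) ⟩
      e v * 0#                              ≈⟨ zeroʳ _ ⟩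
      0#                                    ≈⟨ trans (*-congˡ (zeroʳ _)) (zeroʳ _) ⟨
      e g * (gatePower k v * 0#)            ≈⟨ *-congˡ (*-congˡ (weight-outside k v∉B)) ⟨
      e g * (gatePower k v * weight k v)    ∎

  private
    nonGateTerm-zero : ∀ k {v} → (v ∈ block k → v ≡ gate k) → 𝟙 (v ∈? block k) - 𝟙 (v Fin.≟ gate k) ≈ 0#
    nonGateTerm-zero k {v} member⇒gate with v ∈? block k
    ... | yes v∈B = trans (+-congˡ (-‿cong (𝟙-yes (v Fin.≟ gate k) (member⇒gate v∈B)))) (-‿inverseʳ 1#)
    ... | no v∉B  = trans (+-congˡ (-‿cong (𝟙-no (v Fin.≟ gate k) gate∉))) (-‿inverseʳ 0#)
      where
      gate∉ : v ≢ gate k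
      gate∉ v≡g = v∉B (≡.subst (_∈ block k) (≡.sym v≡g) (gate∈block k))

    nonGateCount : ∀ v → sum (λ k → 𝟙 (v ∈? block k) - 𝟙 (v Fin.≟ gate k)) ≈ 1# - 𝟙 (v Fin.≟ w)
    nonGateCount v with v Fin.≟ w
    ... | yes ≡.refl =
          trans (sum-zero λ k → nonGateTerm-zero k λ v∈B → ≡.sym (gate-root k v∈B)) (sym (-‿inverseʳ 1#))
    ... | no v≢w with nonGateBlock v≢w
    ...   | k₀ , v∈B₀ , v≢g₀ = begin
      sum (λ k → 𝟙 (v ∈? block k) - 𝟙 (v Fin.≟ gate k))
        ≈⟨ sum-single (λ k → 𝟙 (v ∈? block k) - 𝟙 (v Fin.≟ gate k)) k₀
                      (λ k k≢k₀ → nonGateTerm-zero k (isGate k k≢k₀)) ⟩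
      𝟙 (v ∈? block k₀) - 𝟙 (v Fin.≟ gate k₀)
        ≈⟨ +-cong (𝟙-yes (v ∈? block k₀) v∈B₀) (-‿cong (𝟙-no (v Fin.≟ gate k₀) v≢g₀)) ⟩
      1# - 0#
        ∎
      where
      isGate : ∀ k → k ≢ k₀ → v ∈ block k → v ≡ gate k
      isGate k k≢k₀ v∈B with v Fin.≟ gate k
      ... | yes v≡g = v≡g
      ... | no v≢g  = ⊥-elim (k≢k₀ (nonGateBlock-unique v∈B v≢g v∈B₀ v≢g₀))

    gateCount : ∀ v → sum (λ k → 𝟙 (v Fin.≟ gate k)) - (sum (λ k → 𝟙 (v ∈? block k)) - 1#) ≈ 𝟙 (v Fin.≟ w)
    gateCount v = begin
      Σg - (Σb - 1#)
        ≈⟨ solve 2 (λ g b → g :- (b :- con (+ 1)) := con (+ 1) :- (b :- g)) refl Σg Σb ⟩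
      1# - (Σb - Σg)
        ≈⟨ +-congˡ (-‿cong (sum-distrib-sub (λ k → 𝟙 (v ∈? block k)) (λ k → 𝟙 (v Fin.≟ gate k)))) ⟨
      1# - sum (λ k → 𝟙 (v ∈? block k) - 𝟙 (v Fin.≟ gate k))
        ≈⟨ +-congˡ (-‿cong (nonGateCount v)) ⟩
      1# - (1# - 𝟙 (v Fin.≟ w))
        ≈⟨ solve 1 (λ δ → con (+ 1) :- (con (+ 1) :- δ) := δ) refl (𝟙 (v Fin.≟ w)) ⟩
      𝟙 (v Fin.≟ w)
        ∎
      where
      Σg Σb : Carrier
      Σg = sum (λ k → 𝟙 (v Fin.≟ gate k))
      Σb = sum (λ k → 𝟙 (v ∈? block k))

  ⟨e∣xvec⟩≈1 : ⟨ e ∣ xvec F B q ⟩ ≈ 1#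
  ⟨e∣xvec⟩≈1 = begin
    ⟨ e ∣ xvec F B q ⟩                                  ≈⟨ ⟨∣⟩-congʳ e xvec≈ ⟩
    ⟨ e ∣ (λ v → sum (λ k → weight k v) - b v) ⟩        ≈⟨ ⟨∣⟩-distrib-sub e (λ v → sum (λ k → weight k v)) b ⟩
    ⟨ e ∣ (λ v → sum (λ k → weight k v)) ⟩ - ⟨ e ∣ b ⟩  ≈⟨ +-congʳ (⟨∣⟩-sum e weight) ⟩
    sum (λ k → ⟨ e ∣ weight k ⟩) - ⟨ e ∣ b ⟩            ≈⟨ +-congʳ (sum-cong-≋ ⟨e∣weight⟩≈⟨e∣gateAt⟩) ⟩
    sum (λ k → ⟨ e ∣ gateAt k ⟩) - ⟨ e ∣ b ⟩            ≈⟨ +-congʳ (⟨∣⟩-sum e gateAt) ⟨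
    ⟨ e ∣ (λ v → sum (λ k → gateAt k v)) ⟩ - ⟨ e ∣ b ⟩  ≈⟨ ⟨∣⟩-distrib-sub e (λ v → sum (λ k → gateAt k v)) b ⟨
    ⟨ e ∣ (λ v → sum (λ k → gateAt k v) - b v) ⟩        ≈⟨ ⟨∣⟩-congʳ e gateCount ⟩
    ⟨ e ∣ (λ v → 𝟙 (v Fin.≟ w)) ⟩                      ≈⟨ ⟨∣𝟙≟⟩ e w ⟩
    pow F q (D w)                                      ≡⟨ ≡.cong (pow F q) (d-refl w) ⟩
    1#                                                 ∎
    where
    b : Fin N → Carrier
    b v = sum (λ k → 𝟙 (v ∈? block k)) - 1#
    gateAt : Fin r → Fin N → Carrier
    gateAt k v = 𝟙 (v Fin.≟ gate k)
    ⟨e∣weight⟩≈⟨e∣gateAt⟩ : ∀ k → ⟨ e ∣ weight k ⟩ ≈ ⟨ e ∣ gateAt k ⟩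
    ⟨e∣weight⟩≈⟨e∣gateAt⟩ k = trans (⟨e∣weight⟩ k) (sym (⟨∣𝟙≟⟩ e (gate k)))

corollary4p2 : ∀ {c ℓ : Level} (F : Field c ℓ) (N′ : ℕ) (G : Graph (suc N′))
  → Connected G
  → (B : BiBlock G)
  → (d : Fin (suc N′) → Fin (suc N′) → ℕ) → IsDistance G d
  → (q : Field.Carrier F)
  → ¬ (Field._≈_ F q (Field.-_ F (Field.1# F)))
  → (∀ k → ¬ (Field._≈_ F
                (Field._*_ F (Field._*_ F q q)
                   (Field._*_ F (Field._-_ F (fromℕ F (BiBlock.m B k)) (Field.1# F))
                                (Field._-_ F (fromℕ F (BiBlock.n B k)) (Field.1# F))))
                (Field.1# F)))
  → Field._≈_ F
      (∑ F (λ i → Field._*_ F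
                    (Field._+_ F (Field.1# F)
                       (Field._*_ F (Field._-_ F q (Field.1# F)) (qint F q (d i (lastOf N′)))))
                    (xvec F B q i)))
      (Field.1# F)
corollary4p2 F N′ G _ B d isDistance q q≉-1 Δ+1≉1 = begin
  ∑ F weighted                              ≡⟨ ∑≡sum weighted ⟩
  sum weighted                              ≈⟨ sum-cong-≋ weighted≈ ⟩
  ⟨ (λ i → pow F q (d i w)) ∣ xvec F B q ⟩  ≈⟨ XVectorPairing.⟨e∣xvec⟩≈1 F B d isDistance w q nondegenerate ⟩
  1#                                        ∎
  where
  open Field F hiding (zero)
  open FieldSums F
  open import Relation.Binary.Reasoning.Setoid setoid
  w : Fin (suc N′)
  w = lastOf N′
  weighted : Fin (suc N′) → Carrier
  weighted i = (1# + (q - 1#) * qint F q (d i w)) * xvec F B q i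
  weighted≈ : ∀ i → weighted i ≈ pow F q (d i w) * xvec F B q i
  weighted≈ i = *-congʳ (1+[q-1]qint≈pow q (d i w))
  nondegenerate : ∀ k → ¬ ((q + 1#) * Δ F B q k ≈ 0#)
  nondegenerate k = *-≉0 (+1≉0 q≉-1) (-1≉0 (Δ+1≉1 k))
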